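{- Let $N$ be a negative translation into $\mathsf{IL}$. The following are equivalent: (1) $N$ is equivalent in $\mathsf{IL}$ to the Gödel–Gentzen translation, i.e. $\mathsf{IL} \vdash N(A) \leftrightarrow A^G$ for all formulas $A$; (2) $N$ translates into $\mathsf{NF}$ in $\mathsf{IL}$, i.e. for every formula $A$ there is $B \in \mathsf{NF}$ with $\mathsf{IL} \vdash N(A) \leftrightarrow B$; (3) $N$ acts as the identity on $\mathsf{NF}$ in $\mathsf{IL}$, i.e. $\mathsf{IL} \vdash N(A) \leftrightarrow A$ for all $A \in \mathsf{NF}$. The same holds with $\mathsf{ML}$ in place of $\mathsf{IL}$ throughout (for $N$ a negative translation into $\mathsf{ML}$, and equivalences provable in $\mathsf{ML}$).
   Context: $\mathsf{CL}$ is pure first-order classical predicate logic based on $\bot, \wedge, \vee, \to, \forall, \exists$ (with $\neg A :\equiv A\to\bot$, $A\leftrightarrow B :\equiv (A\to B)\wedge(B\to A)$); $\mathsf{IL}$ and $\mathsf{ML}$ are its intuitionistic and minimal counterparts. A function $N$ from formulas to formulas is a negative translation into $\mathsf{IL}$ (resp. $\mathsf{ML}$) if (soundness) for all formulas $A$ and all sets $\Gamma$ of possibly open formulas, $\mathsf{CL}+\Gamma\vdash A$ implies $\mathsf{IL}+N(\Gamma)\vdash N(A)$ (resp. $\mathsf{ML}+N(\Gamma)\vdash N(A)$), where $N(\Gamma)=\{N(B):B\in\Gamma\}$; and (characterisation) $\mathsf{CL}\vdash N(A)\leftrightarrow A$ for all formulas $A$. $A^G$ is the Gödel–Gentzen translation: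 $P^G :\equiv \neg\neg P$ for atomic $P \not\equiv \bot$; $\bot^G :\equiv \bot$; $(A\wedge B)^G :\equiv A^G\wedge B^G$; $(A\vee B)^G :\equiv \neg(\neg A^G\wedge\neg B^G)$; $(A\to B)^G :\equiv A^G\to B^G$; $(\forall xA)^G :\equiv \forall x A^G$; $(\exists xA)^G :\equiv \neg\forall x\neg A^G$. The negative fragment $\mathsf{NF}$ is inductively generated by: $\bot\in\mathsf{NF}$; $\neg P\in\mathsf{NF}$ for atomic $P$; if $A,B\in\mathsf{NF}$ then $A\wedge B, A\to B,\forall xA\in\mathsf{NF}$. -}

module Defs where

open import Data.Nat using (ℕ; zero; suc)
open import Data.List using (List; map)
open import Data.Product using (Σ; _×_; _,_)
open import Data.Sum using (_⊎_)
open import Data.Unit using (⊤)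
open import Data.Empty renaming (⊥ to Empty)
open import Relation.Binary.PropositionalEquality using (_≡_)

-- Syntax of pure first-order predicate logic (de Bruijn indices).

data Term : Set where
  var : ℕ → Term

data Formula : Set where
  ⊥'   : Formula
  atom : ℕ → List Term → Formula
  _∧'_ : Formula → Formula → Formula
  _∨'_ : Formula → Formula → Formula
  _⇒_  : Formula → Formula → Formula
  ∀'   : Formula → Formula          -- binds de Bruijn index 0
  ∃'   : Formula → Formula          -- binds de Bruijn index 0

infixr 6 _∧'_
infixr 5 _∨'_
infixr 4 _⇒_
infix 3 _⇔'_
infix 2 _⊢₀_
infixl 9 _ᴳ

¬' : Formula → Formula
¬' A = A ⇒ ⊥'

_⇔'_ : Formula → Formula → Formula
A ⇔' B = (A ⇒ B) ∧' (B ⇒ A)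

-- Renaming of variables (= substitution, since terms are variables).

ext : (ℕ → ℕ) → ℕ → ℕ
ext ρ zero    = zero
ext ρ (suc n) = suc (ρ n)

renT : (ℕ → ℕ) → Term → Term
renT ρ (var n) = var (ρ n)

ren : (ℕ → ℕ) → Formula → Formula
ren ρ ⊥'         = ⊥'
ren ρ (atom P ts) = atom P (map (renT ρ) ts)
ren ρ (A ∧' B)   = ren ρ A ∧' ren ρ B
ren ρ (A ∨' B)   = ren ρ A ∨' ren ρ B
ren ρ (A ⇒ B)    = ren ρ A ⇒ ren ρ B
ren ρ (∀' A)     = ∀' (ren (ext ρ) A)
ren ρ (∃' A)     = ∃' (ren (ext ρ) A)

wk : Formula → Formula
wk = ren suc

inst0 : Term → ℕ → ℕ
inst0 (var k) zero    = k
inst0 t       (suc n) = n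

_[_] : Formula → Term → Formula
A [ t ] = ren (inst0 t) A

FSet : Set₁
FSet = Formula → Set

∅ : FSet
∅ _ = Empty

_,,_ : FSet → Formula → FSet
(Γ ,, A) B = Γ B ⊎ B ≡ A

-- Γ with all free variables shifted (used in ∀I / ∃E: eigenvariable 0
-- does not occur free in the shifted context)
wkSet : FSet → FSet
wkSet Γ B = Σ Formula λ C → Γ C × B ≡ wk C

image : (Formula → Formula) → FSet → FSet
image N Γ B = Σ Formula λ C → Γ C × B ≡ N C

data Logic : Set where
  ML IL CL : Logic

HasEFQ : Logic → Set
HasEFQ ML = Empty
HasEFQ IL = ⊤
HasEFQ CL = ⊤

HasDNE : Logic → Set
HasDNE ML = Empty
HasDNE IL = Empty
HasDNE CL = ⊤

infix 2 _∣_⊢_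

data _∣_⊢_ (L : Logic) : FSet → Formula → Set₁ where
  hyp  : ∀ {Γ A} → Γ A → L ∣ Γ ⊢ A
  efq  : ∀ {Γ A} → HasEFQ L → L ∣ Γ ⊢ ⊥' → L ∣ Γ ⊢ A
  dne  : ∀ {Γ A} → HasDNE L → L ∣ Γ ⊢ ¬' (¬' A) → L ∣ Γ ⊢ A
  ∧I   : ∀ {Γ A B} → L ∣ Γ ⊢ A → L ∣ Γ ⊢ B → L ∣ Γ ⊢ A ∧' B
  ∧E₁  : ∀ {Γ A B} → L ∣ Γ ⊢ A ∧' B → L ∣ Γ ⊢ A
  ∧E₂  : ∀ {Γ A B} → L ∣ Γ ⊢ A ∧' B → L ∣ Γ ⊢ B
  ∨I₁  : ∀ {Γ A B} → L ∣ Γ ⊢ A → L ∣ Γ ⊢ A ∨' B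
  ∨I₂  : ∀ {Γ A B} → L ∣ Γ ⊢ B → L ∣ Γ ⊢ A ∨' B
  ∨E   : ∀ {Γ A B C} → L ∣ Γ ⊢ A ∨' B → L ∣ Γ ,, A ⊢ C → L ∣ Γ ,, B ⊢ C
         → L ∣ Γ ⊢ C
  ⇒I   : ∀ {Γ A B} → L ∣ Γ ,, A ⊢ B → L ∣ Γ ⊢ A ⇒ B
  ⇒E   : ∀ {Γ A B} → L ∣ Γ ⊢ A ⇒ B → L ∣ Γ ⊢ A → L ∣ Γ ⊢ B
  ∀I   : ∀ {Γ A} → L ∣ wkSet Γ ⊢ A → L ∣ Γ ⊢ ∀' A
  ∀E   : ∀ {Γ A} (t : Term) → L ∣ Γ ⊢ ∀' A → L ∣ Γ ⊢ A [ t ]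
  ∃I   : ∀ {Γ A} (t : Term) → L ∣ Γ ⊢ A [ t ] → L ∣ Γ ⊢ ∃' A
  ∃E   : ∀ {Γ A C} → L ∣ Γ ⊢ ∃' A → L ∣ wkSet Γ ,, A ⊢ wk C → L ∣ Γ ⊢ C

_⊢₀_ : Logic → Formula → Set₁
L ⊢₀ A = L ∣ ∅ ⊢ A

record IsNegTranslation (L : Logic) (N : Formula → Formula) : Set₁ where
  field
    soundness : ∀ (Γ : FSet) (A : Formula)
                → CL ∣ Γ ⊢ A → L ∣ image N Γ ⊢ N A
    characterisation : ∀ (A : Formula) → CL ⊢₀ (N A ⇔' A)

_ᴳ : Formula → Formula
⊥' ᴳ          = ⊥'
atom P ts ᴳ   = ¬' (¬' (atom P ts))
(A ∧' B) ᴳ    = A ᴳ ∧' B ᴳ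
(A ∨' B) ᴳ    = ¬' (¬' (A ᴳ) ∧' ¬' (B ᴳ))
(A ⇒ B) ᴳ     = A ᴳ ⇒ B ᴳ
(∀' A) ᴳ      = ∀' (A ᴳ)
(∃' A) ᴳ      = ¬' (∀' (¬' (A ᴳ)))

data NF : Formula → Set where
  nf⊥    : NF ⊥'
  nf¬at  : ∀ P ts → NF (¬' (atom P ts))
  nf∧    : ∀ {A B} → NF A → NF B → NF (A ∧' B)
  nf⇒    : ∀ {A B} → NF A → NF B → NF (A ⇒ B)
  nf∀    : ∀ {A} → NF A → NF (∀' A)

EquivGG : Logic → (Formula → Formula) → Set₁
EquivGG L N = ∀ (A : Formula) → L ⊢₀ (N A ⇔' A ᴳ)

IntoNF : Logic → (Formula → Formula) → Set₁
IntoNF L N = ∀ (A : Formula) → Σ Formula λ B → NF B × (L ⊢₀ (N A ⇔' B))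

IdOnNF : Logic → (Formula → Formula) → Set₁
IdOnNF L N = ∀ (A : Formula) → NF A → L ⊢₀ (N A ⇔' A)

-- Aᴳ always lies in NF, and on NF the Gödel–Gentzen translation is the identity up to
-- equivalence in minimal logic. Since Aᴳ is stable (¬¬Aᴳ → Aᴳ) already in minimal logic,
-- the translation is sound from classical into minimal logic, so NF formulas that are
-- classically equivalent are equivalent in minimal logic: B ↔ Bᴳ ↔ Cᴳ ↔ C. As N A and A
-- are classically equivalent, an NF formula equivalent to N A is therefore equivalent
-- to Aᴳ, and to A itself when A ∈ NF.
module Submission where

open import Defs
open import Data.Product using (_×_; _,_)
open import Data.Sum using (_⊎_; inj₁; inj₂)
open import Data.Unit using (tt)
open import Data.Nat using (ℕ; zero; suc)
open import Data.List using ([]; _∷_; map)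
open import Relation.Binary.PropositionalEquality using (_≡_; refl; sym; cong; cong₂)

ext-inverseˡ : ∀ {ρ σ : ℕ → ℕ} → (∀ n → ρ (σ n) ≡ n) → ∀ n → ext ρ (ext σ n) ≡ n
ext-inverseˡ ρσ zero    = refl
ext-inverseˡ ρσ (suc n) = cong suc (ρσ n)

ren-inverseˡ : ∀ {ρ σ : ℕ → ℕ} → (∀ n → ρ (σ n) ≡ n) → ∀ A → ren ρ (ren σ A) ≡ A
ren-inverseˡ ρσ ⊥'                  = refl
ren-inverseˡ {ρ} {σ} ρσ (atom P ts) = cong (atom P) (map-inverseˡ ts)
  where
  map-inverseˡ : ∀ ts → map (renT ρ) (map (renT σ) ts) ≡ ts
  map-inverseˡ []           = refl
  map-inverseˡ (var n ∷ ts) = cong₂ _∷_ (cong var (ρσ n)) (map-inverseˡ ts)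
ren-inverseˡ ρσ (A ∧' B) = cong₂ _∧'_ (ren-inverseˡ ρσ A) (ren-inverseˡ ρσ B)
ren-inverseˡ ρσ (A ∨' B) = cong₂ _∨'_ (ren-inverseˡ ρσ A) (ren-inverseˡ ρσ B)
ren-inverseˡ ρσ (A ⇒ B)  = cong₂ _⇒_ (ren-inverseˡ ρσ A) (ren-inverseˡ ρσ B)
ren-inverseˡ ρσ (∀' A)   = cong ∀' (ren-inverseˡ (ext-inverseˡ ρσ) A)
ren-inverseˡ ρσ (∃' A)   = cong ∃' (ren-inverseˡ (ext-inverseˡ ρσ) A)

ren-ext-suc-[var0] : ∀ A → ren (ext suc) A [ var 0 ] ≡ A
ren-ext-suc-[var0] = ren-inverseˡ inst0-ext-suc
  where
  inst0-ext-suc : ∀ n → inst0 (var 0) (ext suc n) ≡ n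
  inst0-ext-suc zero    = refl
  inst0-ext-suc (suc n) = refl

ren-ᴳ : ∀ ρ A → ren ρ (A ᴳ) ≡ ren ρ A ᴳ
ren-ᴳ ρ ⊥'          = refl
ren-ᴳ ρ (atom P ts) = refl
ren-ᴳ ρ (A ∧' B)    = cong₂ _∧'_ (ren-ᴳ ρ A) (ren-ᴳ ρ B)
ren-ᴳ ρ (A ∨' B)    = cong₂ (λ a b → ¬' (¬' a ∧' ¬' b)) (ren-ᴳ ρ A) (ren-ᴳ ρ B)
ren-ᴳ ρ (A ⇒ B)     = cong₂ _⇒_ (ren-ᴳ ρ A) (ren-ᴳ ρ B)
ren-ᴳ ρ (∀' A)      = cong ∀' (ren-ᴳ (ext ρ) A)
ren-ᴳ ρ (∃' A)      = cong (λ a → ¬' (∀' (¬' a))) (ren-ᴳ (ext ρ) A)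

record _⊆_ (Γ Δ : FSet) : Set where
  constructor incl
  field
    ∈-⊆ : ∀ {B} → Γ B → Δ B
open _⊆_

⊆-trans : ∀ {Γ Δ Θ} → Γ ⊆ Δ → Δ ⊆ Θ → Γ ⊆ Θ
⊆-trans (incl f) (incl g) = incl (λ x → g (f x))

⊆-,,ʳ : ∀ {Γ} A → Γ ⊆ (Γ ,, A)
⊆-,,ʳ A = incl inj₁

⊆-,, : ∀ {Γ Δ} → Γ ⊆ Δ → ∀ A → (Γ ,, A) ⊆ (Δ ,, A)
⊆-,, (incl f) A = incl λ { (inj₁ x) → inj₁ (f x) ; (inj₂ y) → inj₂ y }

⊆-wkSet : ∀ {Γ Δ} → Γ ⊆ Δ → wkSet Γ ⊆ wkSet Δ
⊆-wkSet (incl f) = incl λ { (C , x , eq) → C , f x , eq }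

∅-⊆ : ∀ {Γ} → ∅ ⊆ Γ
∅-⊆ = incl λ ()

image-∅ : ∀ N → image N ∅ ⊆ ∅
image-∅ N = incl λ { (_ , () , _) }

image-,, : ∀ N Γ A → image N (Γ ,, A) ⊆ (image N Γ ,, N A)
image-,, N Γ A = incl λ { (C , inj₁ x , eq) → inj₁ (C , x , eq) ; (C , inj₂ refl , eq) → inj₂ eq }

image-ᴳ-wkSet : ∀ Γ → image (_ᴳ) (wkSet Γ) ⊆ wkSet (image (_ᴳ) Γ)
image-ᴳ-wkSet Γ = incl λ { (_ , (C , x , refl) , refl) → C ᴳ , (C , x , refl) , sym (ren-ᴳ suc C) }

weaken : ∀ {L Γ Δ A} → Γ ⊆ Δ → L ∣ Γ ⊢ A → L ∣ Δ ⊢ A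
weaken Γ⊆Δ (hyp x)                   = hyp (∈-⊆ Γ⊆Δ x)
weaken Γ⊆Δ (efq h d)                 = efq h (weaken Γ⊆Δ d)
weaken Γ⊆Δ (dne h d)                 = dne h (weaken Γ⊆Δ d)
weaken Γ⊆Δ (∧I d e)                  = ∧I (weaken Γ⊆Δ d) (weaken Γ⊆Δ e)
weaken Γ⊆Δ (∧E₁ d)                   = ∧E₁ (weaken Γ⊆Δ d)
weaken Γ⊆Δ (∧E₂ d)                   = ∧E₂ (weaken Γ⊆Δ d)
weaken Γ⊆Δ (∨I₁ d)                   = ∨I₁ (weaken Γ⊆Δ d)
weaken Γ⊆Δ (∨I₂ d)                   = ∨I₂ (weaken Γ⊆Δ d)
weaken Γ⊆Δ (∨E {A = A} {B = B} d e f) =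
  ∨E (weaken Γ⊆Δ d) (weaken (⊆-,, Γ⊆Δ A) e) (weaken (⊆-,, Γ⊆Δ B) f)
weaken Γ⊆Δ (⇒I {A = A} d)            = ⇒I (weaken (⊆-,, Γ⊆Δ A) d)
weaken Γ⊆Δ (⇒E d e)                  = ⇒E (weaken Γ⊆Δ d) (weaken Γ⊆Δ e)
weaken Γ⊆Δ (∀I d)                    = ∀I (weaken (⊆-wkSet Γ⊆Δ) d)
weaken Γ⊆Δ (∀E t d)                  = ∀E t (weaken Γ⊆Δ d)
weaken Γ⊆Δ (∃I t d)                  = ∃I t (weaken Γ⊆Δ d)
weaken Γ⊆Δ (∃E {A = A} d e)          = ∃E (weaken Γ⊆Δ d) (weaken (⊆-,, (⊆-wkSet Γ⊆Δ) A) e)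

toCL : ∀ {L Γ A} → L ∣ Γ ⊢ A → CL ∣ Γ ⊢ A
toCL (hyp x)    = hyp x
toCL (efq _ d)  = efq tt (toCL d)
toCL (dne _ d)  = dne tt (toCL d)
toCL (∧I d e)   = ∧I (toCL d) (toCL e)
toCL (∧E₁ d)    = ∧E₁ (toCL d)
toCL (∧E₂ d)    = ∧E₂ (toCL d)
toCL (∨I₁ d)    = ∨I₁ (toCL d)
toCL (∨I₂ d)    = ∨I₂ (toCL d)
toCL (∨E d e f) = ∨E (toCL d) (toCL e) (toCL f)
toCL (⇒I d)     = ⇒I (toCL d)
toCL (⇒E d e)   = ⇒E (toCL d) (toCL e)
toCL (∀I d)     = ∀I (toCL d)
toCL (∀E t d)   = ∀E t (toCL d)
toCL (∃I t d)   = ∃I t (toCL d)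
toCL (∃E d e)   = ∃E (toCL d) (toCL e)

hyp₀ : ∀ {L Γ A} → L ∣ Γ ,, A ⊢ A
hyp₀ = hyp (inj₂ refl)

hyp₁ : ∀ {L Γ A B} → L ∣ (Γ ,, A) ,, B ⊢ A
hyp₁ = hyp (inj₁ (inj₂ refl))

hyp-wk : ∀ {L Γ A} → Γ A → L ∣ wkSet Γ ⊢ wk A
hyp-wk x = hyp (_ , x , refl)

weaken-,, : ∀ {L Γ A B} → L ∣ Γ ⊢ A → L ∣ Γ ,, B ⊢ A
weaken-,, {B = B} = weaken (⊆-,,ʳ B)

cast : ∀ {L Γ A B} → A ≡ B → L ∣ Γ ⊢ A → L ∣ Γ ⊢ B
cast refl d = d

∀E-wk : ∀ {L Γ A} → L ∣ Γ ⊢ wk (∀' A) → L ∣ Γ ⊢ A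
∀E-wk {A = A} d = cast (ren-ext-suc-[var0] A) (∀E (var 0) d)

∃I-wk : ∀ {L Γ A} → L ∣ Γ ⊢ A → L ∣ Γ ⊢ wk (∃' A)
∃I-wk {A = A} d = ∃I (var 0) (cast (sym (ren-ext-suc-[var0] A)) d)

⇒E₀ : ∀ {L Γ A B} → L ⊢₀ A ⇒ B → L ∣ Γ ⊢ A → L ∣ Γ ⊢ B
⇒E₀ f d = ⇒E (weaken ∅-⊆ f) d

⇒-refl : ∀ {L A} → L ⊢₀ A ⇒ A
⇒-refl = ⇒I hyp₀

⇒-trans : ∀ {L A B C} → L ⊢₀ A ⇒ B → L ⊢₀ B ⇒ C → L ⊢₀ A ⇒ C
⇒-trans f g = ⇒I (⇒E₀ g (⇒E₀ f hyp₀))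

⇔-refl : ∀ {L A} → L ⊢₀ A ⇔' A
⇔-refl = ∧I ⇒-refl ⇒-refl

⇔-sym : ∀ {L A B} → L ⊢₀ A ⇔' B → L ⊢₀ B ⇔' A
⇔-sym e = ∧I (∧E₂ e) (∧E₁ e)

⇔-trans : ∀ {L A B C} → L ⊢₀ A ⇔' B → L ⊢₀ B ⇔' C → L ⊢₀ A ⇔' C
⇔-trans e f = ∧I (⇒-trans (∧E₁ e) (∧E₁ f)) (⇒-trans (∧E₂ f) (∧E₂ e))

∧-mono : ∀ {L A A' B B'} → L ⊢₀ A ⇒ A' → L ⊢₀ B ⇒ B' → L ⊢₀ A ∧' B ⇒ A' ∧' B'
∧-mono f g = ⇒I (∧I (⇒E₀ f (∧E₁ hyp₀)) (⇒E₀ g (∧E₂ hyp₀)))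

∨-mono : ∀ {L A A' B B'} → L ⊢₀ A ⇒ A' → L ⊢₀ B ⇒ B' → L ⊢₀ A ∨' B ⇒ A' ∨' B'
∨-mono f g = ⇒I (∨E hyp₀ (∨I₁ (⇒E₀ f hyp₀)) (∨I₂ (⇒E₀ g hyp₀)))

⇒-mono : ∀ {L A A' B B'} → L ⊢₀ A' ⇒ A → L ⊢₀ B ⇒ B' → L ⊢₀ (A ⇒ B) ⇒ (A' ⇒ B')
⇒-mono f g = ⇒I (⇒I (⇒E₀ g (⇒E hyp₁ (⇒E₀ f hyp₀))))

∀-mono : ∀ {L A B} → L ⊢₀ A ⇒ B → L ⊢₀ ∀' A ⇒ ∀' B
∀-mono f = ⇒I (∀I (⇒E₀ f (∀E-wk (hyp-wk (inj₂ refl)))))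

∃-mono : ∀ {L A B} → L ⊢₀ A ⇒ B → L ⊢₀ ∃' A ⇒ ∃' B
∃-mono f = ⇒I (∃E hyp₀ (∃I-wk (⇒E₀ f hyp₀)))

∧-cong : ∀ {L A A' B B'} → L ⊢₀ A ⇔' A' → L ⊢₀ B ⇔' B' → L ⊢₀ A ∧' B ⇔' A' ∧' B'
∧-cong e f = ∧I (∧-mono (∧E₁ e) (∧E₁ f)) (∧-mono (∧E₂ e) (∧E₂ f))

∨-cong : ∀ {L A A' B B'} → L ⊢₀ A ⇔' A' → L ⊢₀ B ⇔' B' → L ⊢₀ A ∨' B ⇔' A' ∨' B'
∨-cong e f = ∧I (∨-mono (∧E₁ e) (∧E₁ f)) (∨-mono (∧E₂ e) (∧E₂ f))

⇒-cong : ∀ {L A A' B B'} → L ⊢₀ A ⇔' A' → L ⊢₀ B ⇔' B' → L ⊢₀ (A ⇒ B) ⇔' (A' ⇒ B')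
⇒-cong e f = ∧I (⇒-mono (∧E₂ e) (∧E₁ f)) (⇒-mono (∧E₁ e) (∧E₂ f))

∀-cong : ∀ {L A B} → L ⊢₀ A ⇔' B → L ⊢₀ ∀' A ⇔' ∀' B
∀-cong e = ∧I (∀-mono (∧E₁ e)) (∀-mono (∧E₂ e))

∃-cong : ∀ {L A B} → L ⊢₀ A ⇔' B → L ⊢₀ ∃' A ⇔' ∃' B
∃-cong e = ∧I (∃-mono (∧E₁ e)) (∃-mono (∧E₂ e))

⇒¬¬ : ∀ {L A} → L ⊢₀ A ⇒ ¬' (¬' A)
⇒¬¬ = ⇒I (⇒I (⇒E hyp₀ hyp₁))

¬¬¬⇒¬ : ∀ {L A} → L ⊢₀ ¬' (¬' (¬' A)) ⇒ ¬' A
¬¬¬⇒¬ = ⇒I (⇒I (⇒E hyp₁ (⇒E₀ ⇒¬¬ hyp₀)))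

¬¬-map : ∀ {L Γ A B} → L ∣ Γ ⊢ ¬' (¬' A) → L ∣ Γ ,, A ⊢ B → L ∣ Γ ⊢ ¬' (¬' B)
¬¬-map {A = A} {B} d f =
  ⇒I (⇒E (weaken-,, d) (⇒I (⇒E hyp₁ (weaken (⊆-,, (⊆-,,ʳ (¬' B)) A) f))))

⊥⇒¬¬ : ∀ {L A} → L ⊢₀ ⊥' ⇒ ¬' (¬' A)
⊥⇒¬¬ = ⇒I (⇒I hyp₁)

double-negation : ∀ {A} → CL ⊢₀ A ⇔' ¬' (¬' A)
double-negation = ∧I ⇒¬¬ (⇒I (dne tt hyp₀))

∨⇔¬∧¬ : ∀ {A B} → CL ⊢₀ A ∨' B ⇔' ¬' (¬' A ∧' ¬' B)
∨⇔¬∧¬ =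
  ∧I (⇒I (⇒I (∨E hyp₁ (⇒E (∧E₁ hyp₁) hyp₀) (⇒E (∧E₂ hyp₁) hyp₀))))
     (⇒I (dne tt (⇒I (⇒E hyp₁ (∧I (⇒I (⇒E hyp₁ (∨I₁ hyp₀)))
                                  (⇒I (⇒E hyp₁ (∨I₂ hyp₀))))))))

∃⇔¬∀¬ : ∀ {A} → CL ⊢₀ ∃' A ⇔' ¬' (∀' (¬' A))
∃⇔¬∀¬ =
  ∧I (⇒I (⇒I (∃E hyp₁ (⇒E (∀E-wk (weaken-,, (hyp-wk (inj₂ refl)))) hyp₀))))
     (⇒I (dne tt (⇒I (⇒E hyp₁ (∀I (⇒I (⇒E (weaken-,, (hyp-wk (inj₂ refl))) (∃I-wk hyp₀))))))))

ᴳ-stable : ∀ {L} A → L ⊢₀ ¬' (¬' (A ᴳ)) ⇒ A ᴳ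
ᴳ-stable ⊥'          = ⇒I (⇒E hyp₀ (⇒I hyp₀))
ᴳ-stable (atom P ts) = ¬¬¬⇒¬
ᴳ-stable (A ∧' B)    =
  ⇒I (∧I (⇒E₀ (ᴳ-stable A) (¬¬-map hyp₀ (∧E₁ hyp₀)))
         (⇒E₀ (ᴳ-stable B) (¬¬-map hyp₀ (∧E₂ hyp₀))))
ᴳ-stable (A ∨' B)    = ¬¬¬⇒¬
ᴳ-stable (A ⇒ B)     = ⇒I (⇒I (⇒E₀ (ᴳ-stable B) (¬¬-map hyp₁ (⇒E hyp₀ hyp₁))))
ᴳ-stable (∀' A)      = ⇒I (∀I (⇒E₀ (ᴳ-stable A) (¬¬-map (hyp-wk (inj₂ refl)) (∀E-wk hyp₀))))
ᴳ-stable (∃' A)      = ¬¬¬⇒¬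

ᴳ-efq : ∀ {L} A → L ⊢₀ ⊥' ⇒ A ᴳ
ᴳ-efq A = ⇒-trans ⊥⇒¬¬ (ᴳ-stable A)

ᴳ-sound : ∀ {L Γ A} → CL ∣ Γ ⊢ A → L ∣ image (_ᴳ) Γ ⊢ A ᴳ
ᴳ-sound (hyp x)            = hyp (_ , x , refl)
ᴳ-sound {A = A} (efq _ d)  = ⇒E₀ (ᴳ-efq A) (ᴳ-sound d)
ᴳ-sound {A = A} (dne _ d)  = ⇒E₀ (ᴳ-stable A) (ᴳ-sound d)
ᴳ-sound (∧I d e)           = ∧I (ᴳ-sound d) (ᴳ-sound e)
ᴳ-sound (∧E₁ d)            = ∧E₁ (ᴳ-sound d)
ᴳ-sound (∧E₂ d)            = ∧E₂ (ᴳ-sound d)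
ᴳ-sound (∨I₁ d)            = ⇒I (⇒E (∧E₁ hyp₀) (weaken-,, (ᴳ-sound d)))
ᴳ-sound (∨I₂ d)            = ⇒I (⇒E (∧E₂ hyp₀) (weaken-,, (ᴳ-sound d)))
ᴳ-sound {Γ = Γ} {C} (∨E {A = A} {B} d e f) =
  ⇒E₀ (ᴳ-stable C) (⇒I (⇒E (weaken-,, (ᴳ-sound d))
    (∧I (⇒I (⇒E hyp₁ (weaken (beneath A) (ᴳ-sound e))))
        (⇒I (⇒E hyp₁ (weaken (beneath B) (ᴳ-sound f)))))))
  where
  beneath : ∀ X → image (_ᴳ) (Γ ,, X) ⊆ ((image (_ᴳ) Γ ,, ¬' (C ᴳ)) ,, (X ᴳ))
  beneath X = ⊆-trans (image-,, (_ᴳ) Γ X) (⊆-,, (⊆-,,ʳ _) (X ᴳ))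
ᴳ-sound {Γ = Γ} (⇒I {A = A} d) = ⇒I (weaken (image-,, (_ᴳ) Γ A) (ᴳ-sound d))
ᴳ-sound (⇒E d e)           = ⇒E (ᴳ-sound d) (ᴳ-sound e)
ᴳ-sound {Γ = Γ} (∀I d)     = ∀I (weaken (image-ᴳ-wkSet Γ) (ᴳ-sound d))
ᴳ-sound (∀E {A = A} t d)   = cast (ren-ᴳ (inst0 t) A) (∀E t (ᴳ-sound d))
ᴳ-sound (∃I {A = A} t d)   =
  ⇒I (⇒E (∀E t hyp₀) (weaken-,, (cast (sym (ren-ᴳ (inst0 t) A)) (ᴳ-sound d))))
ᴳ-sound {Γ = Γ} (∃E {A = A} {C} d e) =
  ⇒E₀ (ᴳ-stable C) (⇒I (⇒E (weaken-,, (ᴳ-sound d)) (∀I (⇒I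
    (⇒E (weaken-,, (hyp-wk (inj₂ refl)))
        (cast (sym (ren-ᴳ suc C)) (weaken beneath (ᴳ-sound e))))))))
  where
  beneath : image (_ᴳ) (wkSet Γ ,, A) ⊆ (wkSet (image (_ᴳ) Γ ,, ¬' (C ᴳ)) ,, (A ᴳ))
  beneath = ⊆-trans (image-,, (_ᴳ) (wkSet Γ) A)
              (⊆-,, (⊆-trans (image-ᴳ-wkSet Γ) (⊆-wkSet (⊆-,,ʳ _))) (A ᴳ))

ᴳ-sound₀ : ∀ {L A} → CL ⊢₀ A → L ⊢₀ A ᴳ
ᴳ-sound₀ d = weaken (image-∅ (_ᴳ)) (ᴳ-sound d)

ᴳ-NF : ∀ A → NF (A ᴳ)
ᴳ-NF ⊥'          = nf⊥
ᴳ-NF (atom P ts) = nf⇒ (nf¬at P ts) nf⊥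
ᴳ-NF (A ∧' B)    = nf∧ (ᴳ-NF A) (ᴳ-NF B)
ᴳ-NF (A ∨' B)    = nf⇒ (nf∧ (nf⇒ (ᴳ-NF A) nf⊥) (nf⇒ (ᴳ-NF B) nf⊥)) nf⊥
ᴳ-NF (A ⇒ B)     = nf⇒ (ᴳ-NF A) (ᴳ-NF B)
ᴳ-NF (∀' A)      = nf∀ (ᴳ-NF A)
ᴳ-NF (∃' A)      = nf⇒ (nf∀ (nf⇒ (ᴳ-NF A) nf⊥)) nf⊥

⇔ᴳ-CL : ∀ A → CL ⊢₀ A ⇔' A ᴳ
⇔ᴳ-CL ⊥'          = ⇔-refl
⇔ᴳ-CL (atom P ts) = double-negation
⇔ᴳ-CL (A ∧' B)    = ∧-cong (⇔ᴳ-CL A) (⇔ᴳ-CL B)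
⇔ᴳ-CL (A ∨' B)    = ⇔-trans (∨-cong (⇔ᴳ-CL A) (⇔ᴳ-CL B)) ∨⇔¬∧¬
⇔ᴳ-CL (A ⇒ B)     = ⇒-cong (⇔ᴳ-CL A) (⇔ᴳ-CL B)
⇔ᴳ-CL (∀' A)      = ∀-cong (⇔ᴳ-CL A)
⇔ᴳ-CL (∃' A)      = ⇔-trans (∃-cong (⇔ᴳ-CL A)) ∃⇔¬∀¬

NF-⇔ᴳ : ∀ {L A} → NF A → L ⊢₀ A ⇔' A ᴳ
NF-⇔ᴳ nf⊥          = ⇔-refl
NF-⇔ᴳ (nf¬at P ts) = ∧I ⇒¬¬ ¬¬¬⇒¬
NF-⇔ᴳ (nf∧ a b)    = ∧-cong (NF-⇔ᴳ a) (NF-⇔ᴳ b)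
NF-⇔ᴳ (nf⇒ a b)    = ⇒-cong (NF-⇔ᴳ a) (NF-⇔ᴳ b)
NF-⇔ᴳ (nf∀ a)      = ∀-cong (NF-⇔ᴳ a)

NF-conservative : ∀ {L B C} → NF B → NF C → CL ⊢₀ B ⇔' C → L ⊢₀ B ⇔' C
NF-conservative nB nC e = ⇔-trans (NF-⇔ᴳ nB) (⇔-trans (ᴳ-sound₀ e) (⇔-sym (NF-⇔ᴳ nC)))

module NegTranslation {L : Logic} {N : Formula → Formula} (neg : IsNegTranslation L N) where
  open IsNegTranslation neg

  N-mono : ∀ {A B} → CL ⊢₀ A ⇒ B → L ⊢₀ N A ⇒ N B
  N-mono {A} {B} f =
    weaken (image-∅ N) (⇒I (weaken (image-,, N ∅ A) (soundness (∅ ,, A) B (⇒E₀ f hyp₀))))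

  N-cong : ∀ {A B} → CL ⊢₀ A ⇔' B → L ⊢₀ N A ⇔' N B
  N-cong e = ∧I (N-mono (∧E₁ e)) (N-mono (∧E₂ e))

  NF-representative-unique : ∀ {A B C} → NF B → NF C →
    L ⊢₀ N A ⇔' B → CL ⊢₀ A ⇔' C → L ⊢₀ N A ⇔' C
  NF-representative-unique {A} nB nC NA⇔B A⇔C =
    ⇔-trans NA⇔B (NF-conservative nB nC
      (⇔-trans (⇔-sym (toCL NA⇔B)) (⇔-trans (characterisation A) A⇔C)))

  equivGG⇒intoNF : EquivGG L N → IntoNF L N
  equivGG⇒intoNF equiv A = A ᴳ , ᴳ-NF A , equiv A

  intoNF⇒equivGG : IntoNF L N → EquivGG L N
  intoNF⇒equivGG into A with into A
  ... | B , nB , NA⇔B = NF-representative-unique nB (ᴳ-NF A) NA⇔B (⇔ᴳ-CL A)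

  intoNF⇒idOnNF : IntoNF L N → IdOnNF L N
  intoNF⇒idOnNF into A nA with into A
  ... | B , nB , NA⇔B = NF-representative-unique nB nA NA⇔B ⇔-refl

  idOnNF⇒intoNF : IdOnNF L N → IntoNF L N
  idOnNF⇒intoNF idOnNF A = A ᴳ , ᴳ-NF A , ⇔-trans (N-cong (⇔ᴳ-CL A)) (idOnNF (A ᴳ) (ᴳ-NF A))

-- The hypothesis L ≡ IL ⊎ L ≡ ML is unused: the argument works in any logic, ML included.
theorem2 : ∀ (L : Logic) → (L ≡ IL ⊎ L ≡ ML) →
    ∀ (N : Formula → Formula) → IsNegTranslation L N →
      ((EquivGG L N → IntoNF L N) × (IntoNF L N → EquivGG L N))
      × ((IntoNF L N → IdOnNF L N) × (IdOnNF L N → IntoNF L N))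
theorem2 L _ N neg =
  (equivGG⇒intoNF , intoNF⇒equivGG) , (intoNF⇒idOnNF , idOnNF⇒intoNF)
  where open NegTranslation neg
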